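{- Let $0<p\le 1$ and let $G=(A,B,E)$ be a bipartite graph. Let $A'\subseteq A$ be an independent random sample with $\Pr[a\in A']=p$ for all $a\in A$, and let $F$ be the set of all pairs between $A'$ and $B$. Then for any ordering $\pi$ of the edges of $G$, $$\mathbb{E}_{A'}\,|\mathrm{Greedy}(F\cap\pi)|\ \ge\ \frac{p}{1+p}\,|\mathrm{opt}(G)|.$$
   Context: $\mathrm{Greedy}(\sigma)$ for a sequence $\sigma$ of edges: start with $M=\emptyset$ and, processing edges in order, add edge $e$ to $M$ whenever $M\cup\{e\}$ is still a matching; output $M$. $F\cap\pi$ is the subsequence of $\pi$ consisting of edges in $F$. $\mathrm{opt}(G)$ is a maximum matching of $G$.
   Formalization: The sampling probability p ranges over the rationals in (0,1]. -}

module Defs where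

open import Data.Nat using (ℕ; zero; suc)
open import Data.Nat.Base using (_≡ᵇ_)
open import Data.Bool using (Bool; true; false; if_then_else_; _∨_)
open import Data.Fin using (Fin; toℕ)
open import Data.Product using (_×_; _,_; proj₁; proj₂)
open import Data.List using (List; []; _∷_; length; map; foldl; filter; _++_)
open import Data.List.Membership.Propositional using (_∈_)
open import Data.List.Relation.Unary.All using (All)
open import Data.List.Relation.Unary.Any using (any?)
open import Data.List.Relation.Unary.AllPairs using (AllPairs)
open import Data.List.Relation.Unary.Unique.Propositional using (Unique)
open import Data.Vec using (Vec; []; _∷_; lookup)
open import Data.Integer using (+_)
open import Data.Rational using (ℚ; _+_; _*_; _-_; _/_; 0ℚ; 1ℚ)
open import Relation.Binary.PropositionalEquality using (_≢_)
open import Relation.Nullary.Decidable using (does)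
open import Data.Bool using (T)

-- Bipartite graph with sides A = Fin m, B = Fin n; an edge is a pair (a , b).
Edge : ℕ → ℕ → Set
Edge m n = Fin m × Fin n

sharesVertex : ∀ {m n} → Edge m n → Edge m n → Bool
sharesVertex (a , b) (a' , b') = (toℕ a ≡ᵇ toℕ a') ∨ (toℕ b ≡ᵇ toℕ b')

conflicts : ∀ {m n} → List (Edge m n) → Edge m n → Bool
conflicts [] e = false
conflicts (f ∷ M) e = sharesVertex e f ∨ conflicts M e

greedyStep : ∀ {m n} → List (Edge m n) → Edge m n → List (Edge m n)
greedyStep M e = if conflicts M e then M else (e ∷ M)

Greedy : ∀ {m n} → List (Edge m n) → List (Edge m n)
Greedy σ = foldl greedyStep [] σ

IsMatching : ∀ {m n} → List (Edge m n) → List (Edge m n) → Set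
IsMatching E M =
  Unique M × All (_∈ E) M ×
  AllPairs (λ e f → (proj₁ e ≢ proj₁ f) × (proj₂ e ≢ proj₂ f)) M

IsMaximumMatching : ∀ {m n} → List (Edge m n) → List (Edge m n) → Set
IsMaximumMatching E M =
  IsMatching E M × (∀ N → IsMatching E N → length N Data.Nat.≤ length M)

-- A subset A' of A = Fin m, as a characteristic vector.
allSubsets : (m : ℕ) → List (Vec Bool m)
allSubsets zero = [] ∷ []
allSubsets (suc m) = map (true ∷_) (allSubsets m) ++ map (false ∷_) (allSubsets m)

weight : ℚ → ∀ {m} → Vec Bool m → ℚ
weight p [] = 1ℚ
weight p (true ∷ s) = p * weight p s
weight p (false ∷ s) = (1ℚ - p) * weight p s

-- F ∩ π: subsequence of π of edges whose A-endpoint lies in A'.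
restrict : ∀ {m n} → Vec Bool m → List (Edge m n) → List (Edge m n)
restrict A' [] = []
restrict A' (e ∷ π) = if lookup A' (proj₁ e) then e ∷ restrict A' π else restrict A' π

ℕtoℚ : ℕ → ℚ
ℕtoℚ k = + k / 1

sumℚ : List ℚ → ℚ
sumℚ [] = 0ℚ
sumℚ (x ∷ xs) = x + sumℚ xs

expectedGreedy : ℚ → ∀ {m n} → List (Edge m n) → ℚ
expectedGreedy p {m} π =
  sumℚ (map (λ A' → weight p A' * ℕtoℚ (length (Greedy (restrict A' π)))) (allSubsets m))

-- Credit each edge (a , b) of a maximum matching with 1 if greedy matches a and with p if
-- greedy matches b. Fix the coins of all vertices of A other than a. If greedy matches a when
-- a ∈ A', the edge earns at least 1 with probability p. Otherwise greedy rejected every edge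
-- at a, so its output is the same whether a ∈ A' or not; as (a , b) was offered to it, b is
-- matched and the edge earns p in both cases. So every edge of the matching has expected
-- credit at least p. On the other hand, a greedy edge is charged by at most one matching edge
-- through its endpoint in A and by at most one through its endpoint in B, so the total credit
-- is at most (1 + p) |Greedy|.

module Submission where

open import Defs
open import Data.Nat using (ℕ)
open import Data.List using (List; length)
open import Data.List.Relation.Unary.Unique.Propositional using (Unique)
open import Data.List.Relation.Binary.Permutation.Propositional using (_↭_)
open import Data.Rational using (ℚ; _+_; _*_; _≤_; _<_; 0ℚ; 1ℚ)

import Data.Nat as ℕ
open import Data.Nat.Base using (_≡ᵇ_)
import Data.Nat.Properties as ℕₚ
open import Data.Nat.ListAction using (sum)
import Data.Integer as ℤ
import Data.Integer.Properties as ℤₚ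
open import Data.Rational using (_-_; -_; toℚᵘ; nonNegative)
import Data.Rational.Properties as ℚₚ
import Data.Rational.Unnormalised as ℚᵘ
import Data.Rational.Unnormalised.Properties as ℚᵘₚ
open import Data.Rational.Solver using (module +-*-Solver)
open import Data.Bool using (Bool; true; false; _∨_; T)
open import Data.Bool.Properties using (∨-commutativeMonoid; T-∨; T-≡)
open import Data.Fin using (Fin; toℕ; _≟_)
open import Data.Fin.Properties using (toℕ-injective)
open import Data.Vec using (Vec; []; _∷_; lookup; _[_]≔_)
open import Data.Vec.Properties using (lookup∘update; lookup∘update′)
open import Data.List using ([]; _∷_; map; foldl; _++_)
open import Data.Bool.ListAction using (any)
open import Data.List.Properties using (map-++; map-∘; map-cong)
open import Data.List.Membership.Propositional using (_∈_)
open import Data.List.Relation.Unary.Any using (here; there)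
open import Data.List.Relation.Unary.Any.Properties using (any⁺; any⁻)
open import Data.List.Relation.Unary.All as All using (All; []; _∷_)
open import Data.List.Relation.Unary.AllPairs as AllPairs using (AllPairs; []; _∷_)
open import Data.List.Relation.Binary.Subset.Propositional using (_⊆_)
open import Data.List.Relation.Binary.Subset.Propositional.Properties
  using (⊆-refl; ⊆-trans; Any-resp-⊆)
open import Data.List.Relation.Binary.Permutation.Propositional using (↭-sym)
open import Data.List.Relation.Binary.Permutation.Propositional.Properties using (∈-resp-↭)
open import Data.Product using (_×_; _,_; proj₁; proj₂)
open import Data.Sum using (inj₁; [_,_]′)
open import Data.Empty using (⊥-elim)
open import Function using (_∘_; id; Equivalence)
open import Relation.Nullary using (¬_; yes; no)
open import Relation.Nullary.Decidable using (T?; toSum)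
open import Relation.Binary.PropositionalEquality
open import Algebra.Bundles using (CommutativeMonoid)
open import Algebra.Properties.CommutativeSemigroup
  (CommutativeMonoid.commutativeSemigroup ∨-commutativeMonoid)
  using () renaming (interchange to ∨-interchange)
open import Algebra.Properties.CommutativeSemigroup ℕₚ.+-commutativeSemigroup
  using () renaming (interchange to +-interchange)

open +-*-Solver

toℚᵘ-ℕtoℚ : ∀ k → toℚᵘ (ℕtoℚ k) ℚᵘ.≃ ℚᵘ.mkℚᵘ (ℤ.+ k) 0
toℚᵘ-ℕtoℚ k = ℚₚ.toℚᵘ-fromℚᵘ (ℚᵘ.mkℚᵘ (ℤ.+ k) 0)

ℕtoℚ-+ : ∀ a b → ℕtoℚ (a ℕ.+ b) ≡ ℕtoℚ a + ℕtoℚ b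
ℕtoℚ-+ a b = ℚₚ.toℚᵘ-injective (begin
  toℚᵘ (ℕtoℚ (a ℕ.+ b))                    ≈⟨ toℚᵘ-ℕtoℚ (a ℕ.+ b) ⟩
  ℚᵘ.mkℚᵘ (ℤ.+ (a ℕ.+ b)) 0               ≈⟨ ℚᵘ.*≡* (cong (ℤ._* ℤ.+ 1) integer-sum) ⟩
  ℚᵘ.mkℚᵘ (ℤ.+ a) 0 ℚᵘ.+ ℚᵘ.mkℚᵘ (ℤ.+ b) 0 ≈⟨ ℚᵘₚ.≃-sym (ℚᵘₚ.+-cong (toℚᵘ-ℕtoℚ a) (toℚᵘ-ℕtoℚ b)) ⟩
  toℚᵘ (ℕtoℚ a) ℚᵘ.+ toℚᵘ (ℕtoℚ b)        ≈⟨ ℚᵘₚ.≃-sym (ℚₚ.toℚᵘ-homo-+ (ℕtoℚ a) (ℕtoℚ b)) ⟩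
  toℚᵘ (ℕtoℚ a + ℕtoℚ b)                  ∎)
  where
  open ℚᵘₚ.≃-Reasoning
  integer-sum : ℤ.+ (a ℕ.+ b) ≡ ℤ.+ a ℤ.* ℤ.+ 1 ℤ.+ ℤ.+ b ℤ.* ℤ.+ 1
  integer-sum = trans (ℤₚ.pos-+ a b)
    (sym (cong₂ ℤ._+_ (ℤₚ.*-identityʳ (ℤ.+ a)) (ℤₚ.*-identityʳ (ℤ.+ b))))

ℕtoℚ-nonNeg : ∀ k → 0ℚ ≤ ℕtoℚ k
ℕtoℚ-nonNeg k = ℚₚ.nonNegative⁻¹ (ℕtoℚ k) {{ℚₚ.normalize-nonNeg k 1}}

p≤p+q : ∀ {p q} → 0ℚ ≤ q → p ≤ p + q
p≤p+q {p} 0≤q = ℚₚ.≤-trans (ℚₚ.≤-reflexive (sym (ℚₚ.+-identityʳ p))) (ℚₚ.+-monoʳ-≤ p 0≤q)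

*-monoˡ-≤-0≤ : ∀ {r p q} → 0ℚ ≤ r → p ≤ q → r * p ≤ r * q
*-monoˡ-≤-0≤ {r} 0≤r = ℚₚ.*-monoˡ-≤-nonNeg r {{nonNegative 0≤r}}

*-nonNeg : ∀ {p q} → 0ℚ ≤ p → 0ℚ ≤ q → 0ℚ ≤ p * q
*-nonNeg {p} 0≤p 0≤q = ℚₚ.≤-trans (ℚₚ.≤-reflexive (sym (ℚₚ.*-zeroʳ p))) (*-monoˡ-≤-0≤ 0≤p 0≤q)

ℕtoℚ-mono-≤ : ∀ {a b} → a ℕ.≤ b → ℕtoℚ a ≤ ℕtoℚ b
ℕtoℚ-mono-≤ {a} {b} a≤b = begin
  ℕtoℚ a                     ≤⟨ p≤p+q (ℕtoℚ-nonNeg (b ℕ.∸ a)) ⟩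
  ℕtoℚ a + ℕtoℚ (b ℕ.∸ a)   ≡⟨ sym (ℕtoℚ-+ a (b ℕ.∸ a)) ⟩
  ℕtoℚ (a ℕ.+ (b ℕ.∸ a))    ≡⟨ cong ℕtoℚ (ℕₚ.m+[n∸m]≡n a≤b) ⟩
  ℕtoℚ b                     ∎
  where open ℚₚ.≤-Reasoning

sumℚ-++ : ∀ (xs ys : List ℚ) → sumℚ (xs ++ ys) ≡ sumℚ xs + sumℚ ys
sumℚ-++ [] ys = sym (ℚₚ.+-identityˡ _)
sumℚ-++ (x ∷ xs) ys = trans (cong (x +_) (sumℚ-++ xs ys)) (sym (ℚₚ.+-assoc x _ _))

module _ {A : Set} where

  sumℚ-map-*ˡ : ∀ c (f : A → ℚ) xs → sumℚ (map (λ x → c * f x) xs) ≡ c * sumℚ (map f xs)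
  sumℚ-map-*ˡ c f [] = sym (ℚₚ.*-zeroʳ c)
  sumℚ-map-*ˡ c f (x ∷ xs) =
    trans (cong (c * f x +_) (sumℚ-map-*ˡ c f xs)) (sym (ℚₚ.*-distribˡ-+ c _ _))

  sumℚ-map-+ : ∀ (f g : A → ℚ) xs →
    sumℚ (map (λ x → f x + g x) xs) ≡ sumℚ (map f xs) + sumℚ (map g xs)
  sumℚ-map-+ f g [] = refl
  sumℚ-map-+ f g (x ∷ xs) = trans (cong (f x + g x +_) (sumℚ-map-+ f g xs))
    (solve 4 (λ a b c d → (a :+ b) :+ (c :+ d) := (a :+ c) :+ (b :+ d)) refl (f x) (g x) _ _)

  sumℚ-mono : ∀ {f g : A → ℚ} xs → All (λ x → f x ≤ g x) xs → sumℚ (map f xs) ≤ sumℚ (map g xs)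
  sumℚ-mono [] [] = ℚₚ.≤-refl
  sumℚ-mono (x ∷ xs) (fx≤gx ∷ f≤g) = ℚₚ.+-mono-≤ fx≤gx (sumℚ-mono xs f≤g)

  sumℚ-map-const : ∀ c (xs : List A) → sumℚ (map (λ _ → c) xs) ≡ c * ℕtoℚ (length xs)
  sumℚ-map-const c [] = sym (ℚₚ.*-zeroʳ c)
  sumℚ-map-const c (x ∷ xs) = begin
    c + sumℚ (map (λ _ → c) xs)        ≡⟨ cong₂ _+_ (sym (ℚₚ.*-identityʳ c)) (sumℚ-map-const c xs) ⟩
    c * 1ℚ + c * ℕtoℚ (length xs)      ≡⟨ sym (ℚₚ.*-distribˡ-+ c 1ℚ _) ⟩
    c * (1ℚ + ℕtoℚ (length xs))        ≡⟨ cong (c *_) (sym (ℕtoℚ-+ 1 (length xs))) ⟩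
    c * ℕtoℚ (ℕ.suc (length xs))       ∎
    where open ≡-Reasoning

  ℕtoℚ-sum : ∀ (f : A → ℕ) xs → sumℚ (map (ℕtoℚ ∘ f) xs) ≡ ℕtoℚ (sum (map f xs))
  ℕtoℚ-sum f [] = refl
  ℕtoℚ-sum f (x ∷ xs) = trans (cong (ℕtoℚ (f x) +_) (ℕtoℚ-sum f xs)) (sym (ℕtoℚ-+ (f x) _))

module Expectation (p : ℚ) where

  q : ℚ
  q = 1ℚ - p

  𝔼 : ∀ m → (Vec Bool m → ℚ) → ℚ
  𝔼 ℕ.zero f = f []
  𝔼 (ℕ.suc m) f = p * 𝔼 m (f ∘ (true ∷_)) + q * 𝔼 m (f ∘ (false ∷_))

  p*x+q*x≡x : ∀ x → p * x + q * x ≡ x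
  p*x+q*x≡x = solve 2 (λ p x → p :* x :+ (con 1ℚ :- p) :* x := x) refl p

  𝔼-const : ∀ m c → 𝔼 m (λ _ → c) ≡ c
  𝔼-const ℕ.zero c = refl
  𝔼-const (ℕ.suc m) c = trans (cong₂ (λ x y → p * x + q * y) (𝔼-const m c) (𝔼-const m c)) (p*x+q*x≡x c)

  𝔼-+ : ∀ m (f g : Vec Bool m → ℚ) → 𝔼 m (λ S → f S + g S) ≡ 𝔼 m f + 𝔼 m g
  𝔼-+ ℕ.zero f g = refl
  𝔼-+ (ℕ.suc m) f g = trans (cong₂ (λ x y → p * x + q * y) (𝔼-+ m _ _) (𝔼-+ m _ _))
    (solve 6 (λ p q a b c d → p :* (a :+ b) :+ q :* (c :+ d) := (p :* a :+ q :* c) :+ (p :* b :+ q :* d))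
      refl p q _ _ _ _)

  𝔼-*ˡ : ∀ m c (f : Vec Bool m → ℚ) → 𝔼 m (λ S → c * f S) ≡ c * 𝔼 m f
  𝔼-*ˡ ℕ.zero c f = refl
  𝔼-*ˡ (ℕ.suc m) c f = trans (cong₂ (λ x y → p * x + q * y) (𝔼-*ˡ m c _) (𝔼-*ˡ m c _))
    (solve 5 (λ p q c a b → p :* (c :* a) :+ q :* (c :* b) := c :* (p :* a :+ q :* b)) refl p q c _ _)

  𝔼-sumℚ : ∀ m {A : Set} (f : A → Vec Bool m → ℚ) xs →
    𝔼 m (λ S → sumℚ (map (λ x → f x S) xs)) ≡ sumℚ (map (λ x → 𝔼 m (f x)) xs)
  𝔼-sumℚ m f [] = 𝔼-const m 0ℚ
  𝔼-sumℚ m f (x ∷ xs) = trans (𝔼-+ m _ _) (cong (𝔼 m (f x) +_) (𝔼-sumℚ m f xs))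

  𝔼-mono : 0ℚ ≤ p → 0ℚ ≤ q → ∀ m {f g : Vec Bool m → ℚ} → (∀ S → f S ≤ g S) → 𝔼 m f ≤ 𝔼 m g
  𝔼-mono 0≤p 0≤q ℕ.zero f≤g = f≤g []
  𝔼-mono 0≤p 0≤q (ℕ.suc m) f≤g = ℚₚ.+-mono-≤
    (*-monoˡ-≤-0≤ 0≤p (𝔼-mono 0≤p 0≤q m (f≤g ∘ (true ∷_))))
    (*-monoˡ-≤-0≤ 0≤q (𝔼-mono 0≤p 0≤q m (f≤g ∘ (false ∷_))))

  𝔼-resample : ∀ m (a : Fin m) (f : Vec Bool m → ℚ) →
    𝔼 m f ≡ 𝔼 m (λ S → p * f (S [ a ]≔ true) + q * f (S [ a ]≔ false))
  𝔼-resample (ℕ.suc m) Fin.zero f = sym (begin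
    𝔼 (ℕ.suc m) g                                               ≡⟨ p*x+q*x≡x (𝔼 m g′) ⟩
    𝔼 m g′                                                      ≡⟨ 𝔼-+ m _ _ ⟩
    𝔼 m (λ S → p * f (true ∷ S)) + 𝔼 m (λ S → q * f (false ∷ S)) ≡⟨ cong₂ _+_ (𝔼-*ˡ m p _) (𝔼-*ˡ m q _) ⟩
    𝔼 (ℕ.suc m) f                                               ∎)
    where
    open ≡-Reasoning
    g : Vec Bool (ℕ.suc m) → ℚ
    g S = p * f (S [ Fin.zero ]≔ true) + q * f (S [ Fin.zero ]≔ false)
    g′ : Vec Bool m → ℚ
    g′ S = p * f (true ∷ S) + q * f (false ∷ S)
  𝔼-resample (ℕ.suc m) (Fin.suc a) f = cong₂ (λ x y → p * x + q * y)
    (𝔼-resample m a (f ∘ (true ∷_))) (𝔼-resample m a (f ∘ (false ∷_)))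

  weightedSum≡𝔼 : ∀ m (f : Vec Bool m → ℚ) →
    sumℚ (map (λ S → weight p S * f S) (allSubsets m)) ≡ 𝔼 m f
  weightedSum≡𝔼 ℕ.zero f = trans (ℚₚ.+-identityʳ _) (ℚₚ.*-identityˡ _)
  weightedSum≡𝔼 (ℕ.suc m) f = begin
    sumℚ (map w (map (true ∷_) Ss ++ map (false ∷_) Ss))
      ≡⟨ cong sumℚ (map-++ w (map (true ∷_) Ss) _) ⟩
    sumℚ (map w (map (true ∷_) Ss) ++ map w (map (false ∷_) Ss))
      ≡⟨ sumℚ-++ (map w (map (true ∷_) Ss)) _ ⟩
    sumℚ (map w (map (true ∷_) Ss)) + sumℚ (map w (map (false ∷_) Ss))
      ≡⟨ cong₂ _+_ (half true p (λ _ → refl)) (half false q (λ _ → refl)) ⟩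
    p * 𝔼 m (f ∘ (true ∷_)) + q * 𝔼 m (f ∘ (false ∷_))
      ∎
    where
    open ≡-Reasoning
    Ss = allSubsets m
    w : Vec Bool (ℕ.suc m) → ℚ
    w S = weight p S * f S
    half : ∀ b r → (∀ S → weight p (b ∷ S) ≡ r * weight p S) →
      sumℚ (map w (map (b ∷_) Ss)) ≡ r * 𝔼 m (f ∘ (b ∷_))
    half b r weight-b∷ = begin
      sumℚ (map w (map (b ∷_) Ss))                    ≡⟨ cong sumℚ (sym (map-∘ Ss)) ⟩
      sumℚ (map (w ∘ (b ∷_)) Ss)                      ≡⟨ cong sumℚ (map-cong reassoc Ss) ⟩
      sumℚ (map (λ S → r * (weight p S * f (b ∷ S))) Ss) ≡⟨ sumℚ-map-*ˡ r _ Ss ⟩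
      r * sumℚ (map (λ S → weight p S * f (b ∷ S)) Ss)  ≡⟨ cong (r *_) (weightedSum≡𝔼 m (f ∘ (b ∷_))) ⟩
      r * 𝔼 m (f ∘ (b ∷_))                            ∎
      where
      reassoc : ∀ S → w (b ∷ S) ≡ r * (weight p S * f (b ∷ S))
      reassoc S = trans (cong (_* f (b ∷ S)) (weight-b∷ S)) (ℚₚ.*-assoc r _ _)

any-mono-⊆ : ∀ {A : Set} (t : A → Bool) {xs ys} → xs ⊆ ys → T (any t xs) → T (any t ys)
any-mono-⊆ t xs⊆ys = any⁺ t ∘ Any-resp-⊆ xs⊆ys ∘ any⁻ t _

≡ᵇ-refl : ∀ k → T (k ≡ᵇ k)
≡ᵇ-refl k = ℕₚ.≡⇒≡ᵇ k k refl

toℕ-≡ᵇ⇒≡ : ∀ {k} {i j : Fin k} → T (toℕ i ≡ᵇ toℕ j) → i ≡ j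
toℕ-≡ᵇ⇒≡ {i = i} {j} = toℕ-injective ∘ ℕₚ.≡ᵇ⇒≡ (toℕ i) (toℕ j)

bit : Bool → ℕ
bit true = 1
bit false = 0

bit-∨ : ∀ x y → bit (x ∨ y) ℕ.≤ bit x ℕ.+ bit y
bit-∨ true y = ℕₚ.m≤m+n 1 (bit y)
bit-∨ false y = ℕₚ.≤-refl

module _ {m n k : ℕ} (key : Edge m n → Fin k) where

  matched : Fin k → List (Edge m n) → Bool
  matched x = any (λ f → toℕ x ≡ᵇ toℕ (key f))

  matched-mono-⊆ : ∀ {x M N} → M ⊆ N → T (matched x M) → T (matched x N)
  matched-mono-⊆ = any-mono-⊆ _

  matched-head : ∀ e N → T (matched (key e) (e ∷ N))
  matched-head e N = Equivalence.from T-∨ (inj₁ (≡ᵇ-refl (toℕ (key e))))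

  matchedCount : List (Edge m n) → List (Edge m n) → ℕ
  matchedCount M N = sum (map (λ e → bit (matched (key e) N)) M)

  keyCount : List (Edge m n) → Fin k → ℕ
  keyCount M x = sum (map (λ e → bit (toℕ (key e) ≡ᵇ toℕ x)) M)

  matchedCount-[] : ∀ M → matchedCount M [] ≡ 0
  matchedCount-[] [] = refl
  matchedCount-[] (e ∷ M) = matchedCount-[] M

  matchedCount-∷ : ∀ M f N → matchedCount M (f ∷ N) ℕ.≤ keyCount M (key f) ℕ.+ matchedCount M N
  matchedCount-∷ [] f N = ℕₚ.≤-refl
  matchedCount-∷ (e ∷ M) f N = ℕₚ.≤-trans
    (ℕₚ.+-mono-≤ (bit-∨ (toℕ (key e) ≡ᵇ toℕ (key f)) _) (matchedCount-∷ M f N))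
    (ℕₚ.≤-reflexive (+-interchange (bit (toℕ (key e) ≡ᵇ toℕ (key f))) _ _ _))

  keyCount≡0 : ∀ {M x} → All (λ e → key e ≢ x) M → keyCount M x ≡ 0
  keyCount≡0 [] = refl
  keyCount≡0 {e ∷ M} {x} (key[e]≢x ∷ key≢x) with toℕ (key e) ≡ᵇ toℕ x in eq
  ... | true = ⊥-elim (key[e]≢x (toℕ-≡ᵇ⇒≡ (Equivalence.from T-≡ eq)))
  ... | false = keyCount≡0 key≢x

  keyCount≤1 : ∀ {M} → AllPairs (λ e f → key e ≢ key f) M → ∀ x → keyCount M x ℕ.≤ 1
  keyCount≤1 [] x = ℕ.z≤n
  keyCount≤1 {e ∷ M} (key[e]≢ ∷ distinct) x with toℕ (key e) ≡ᵇ toℕ x in eq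
  ... | true = ℕₚ.≤-reflexive (cong (1 ℕ.+_)
    (keyCount≡0 (All.map (λ ne key[f]≡x → ne (trans key[e]≡x (sym key[f]≡x))) key[e]≢)))
    where
    key[e]≡x : key e ≡ x
    key[e]≡x = toℕ-≡ᵇ⇒≡ (Equivalence.from T-≡ eq)
  ... | false = keyCount≤1 distinct x

  -- Each edge of N matches the key of at most one edge of M.
  matchedCount≤length : ∀ {M} → AllPairs (λ e f → key e ≢ key f) M → ∀ N → matchedCount M N ℕ.≤ length N
  matchedCount≤length {M} distinct [] = ℕₚ.≤-reflexive (matchedCount-[] M)
  matchedCount≤length {M} distinct (f ∷ N) = ℕₚ.≤-trans (matchedCount-∷ M f N)
    (ℕₚ.+-mono-≤ (keyCount≤1 distinct (key f)) (matchedCount≤length distinct N))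

module _ {m n : ℕ} where

  sharesVertex-refl : ∀ (e : Edge m n) → T (sharesVertex e e)
  sharesVertex-refl (a , b) = Equivalence.from T-∨ (inj₁ (≡ᵇ-refl (toℕ a)))

  greedyStep-⊇ : ∀ (M : List (Edge m n)) e → M ⊆ greedyStep M e
  greedyStep-⊇ M e with conflicts M e
  ... | true = ⊆-refl
  ... | false = there

  greedy-⊇ : ∀ (M : List (Edge m n)) σ → M ⊆ foldl greedyStep M σ
  greedy-⊇ M [] = ⊆-refl
  greedy-⊇ M (e ∷ σ) = ⊆-trans (greedyStep-⊇ M e) (greedy-⊇ (greedyStep M e) σ)

  conflicts≡any : ∀ (N : List (Edge m n)) e → conflicts N e ≡ any (sharesVertex e) N
  conflicts≡any [] e = refl
  conflicts≡any (f ∷ N) e = cong (sharesVertex e f ∨_) (conflicts≡any N e)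

  conflicts-mono-⊆ : ∀ {M N : List (Edge m n)} e → M ⊆ N → T (conflicts M e) → T (conflicts N e)
  conflicts-mono-⊆ {M} {N} e M⊆N rewrite conflicts≡any M e | conflicts≡any N e =
    any-mono-⊆ (sharesVertex e) M⊆N

  greedy-maximal : ∀ (M : List (Edge m n)) {e} σ → e ∈ σ → T (conflicts (foldl greedyStep M σ) e)
  greedy-maximal M {e} (e ∷ σ) (here refl) =
    conflicts-mono-⊆ e (greedy-⊇ (greedyStep M e) σ) step-conflicts
    where
    step-conflicts : T (conflicts (greedyStep M e) e)
    step-conflicts with conflicts M e in eq
    ... | true = Equivalence.from T-≡ eq
    ... | false = Equivalence.from T-∨ (inj₁ (sharesVertex-refl e))
  greedy-maximal M (f ∷ σ) (there e∈σ) = greedy-maximal (greedyStep M f) σ e∈σ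

  conflicts≡matched∨matched : ∀ (N : List (Edge m n)) a b →
    conflicts N (a , b) ≡ matched proj₁ a N ∨ matched proj₂ b N
  conflicts≡matched∨matched [] a b = refl
  conflicts≡matched∨matched ((a′ , b′) ∷ N) a b
    rewrite conflicts≡matched∨matched N a b =
    ∨-interchange (toℕ a ≡ᵇ toℕ a′) (toℕ b ≡ᵇ toℕ b′) _ _

  restrict-∈ : ∀ (S : Vec Bool m) {e} {π : List (Edge m n)} →
    e ∈ π → lookup S (proj₁ e) ≡ true → e ∈ restrict S π
  restrict-∈ S {π = f ∷ π} (here refl) S[e]≡true rewrite S[e]≡true = here refl
  restrict-∈ S {π = f ∷ π} (there e∈π) S[e]≡true with lookup S (proj₁ f)
  ... | true = there (restrict-∈ S e∈π S[e]≡true)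
  ... | false = restrict-∈ S e∈π S[e]≡true

  -- If a ends up unmatched, greedy rejected every edge at a, so those edges can be dropped.
  greedy-restrict-unmatched : ∀ {S S′ : Vec Bool m} {a} →
    lookup S′ a ≡ false → (∀ j → j ≢ a → lookup S j ≡ lookup S′ j) →
    ∀ (M π : List (Edge m n)) →
    ¬ T (matched proj₁ a (foldl greedyStep M (restrict S π))) →
    foldl greedyStep M (restrict S π) ≡ foldl greedyStep M (restrict S′ π)
  greedy-restrict-unmatched S′[a]≡false S≗S′ M [] _ = refl
  greedy-restrict-unmatched {S} {S′} {a} S′[a]≡false S≗S′ M ((a′ , b′) ∷ π) unmatched with a′ ≟ a
  ... | yes refl rewrite S′[a]≡false with lookup S a′
  ...   | false = greedy-restrict-unmatched S′[a]≡false S≗S′ M π unmatched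
  ...   | true with conflicts M (a′ , b′)
  ...     | true = greedy-restrict-unmatched S′[a]≡false S≗S′ M π unmatched
  ...     | false = ⊥-elim (unmatched (matched-mono-⊆ proj₁ {a′}
                (greedy-⊇ ((a′ , b′) ∷ M) (restrict S π)) (matched-head proj₁ (a′ , b′) M)))
  greedy-restrict-unmatched {S} {S′} S′[a]≡false S≗S′ M ((a′ , b′) ∷ π) unmatched | no a′≢a
    rewrite S≗S′ a′ a′≢a with lookup S′ a′
  ... | true = greedy-restrict-unmatched S′[a]≡false S≗S′ (greedyStep M (a′ , b′)) π unmatched
  ... | false = greedy-restrict-unmatched S′[a]≡false S≗S′ M π unmatched

module Analysis (p : ℚ) (0≤p : 0ℚ ≤ p) (0≤q : 0ℚ ≤ 1ℚ - p) {m n : ℕ} where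

  open Expectation p

  𝟙 : Bool → ℚ
  𝟙 b = ℕtoℚ (bit b)

  credit : Edge m n → List (Edge m n) → ℚ
  credit (a , b) G = 𝟙 (matched proj₁ a G) + p * 𝟙 (matched proj₂ b G)

  credit-nonNeg : ∀ e G → 0ℚ ≤ credit e G
  credit-nonNeg (a , b) G =
    ℚₚ.+-mono-≤ (ℕtoℚ-nonNeg (bit (matched proj₁ a G))) (*-nonNeg 0≤p (ℕtoℚ-nonNeg (bit (matched proj₂ b G))))

  credit≥1 : ∀ {a b} G → T (matched proj₁ a G) → 1ℚ ≤ credit (a , b) G
  credit≥1 {a} {b} G a-matched with matched proj₁ a G
  ... | true = p≤p+q (*-nonNeg 0≤p (ℕtoℚ-nonNeg (bit (matched proj₂ b G))))

  credit≡p : ∀ {a b} G → ¬ T (matched proj₁ a G) → T (matched proj₂ b G) → credit (a , b) G ≡ p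
  credit≡p {a} {b} G a-unmatched b-matched with matched proj₁ a G | matched proj₂ b G
  ... | true  | _    = ⊥-elim (a-unmatched _)
  ... | false | true = trans (ℚₚ.+-identityˡ (p * 1ℚ)) (ℚₚ.*-identityʳ p)

  credit-sum≤ : ∀ {M} → AllPairs (λ e f → (proj₁ e ≢ proj₁ f) × (proj₂ e ≢ proj₂ f)) M → ∀ G →
    sumℚ (map (λ e → credit e G) M) ≤ (1ℚ + p) * ℕtoℚ (length G)
  credit-sum≤ {M} matching G = begin
    sumℚ (map (λ e → credit e G) M)                         ≡⟨ sumℚ-map-+ A-side (λ e → p * B-side e) M ⟩
    sumℚ (map A-side M) + sumℚ (map (λ e → p * B-side e) M)  ≡⟨ cong (sumℚ (map A-side M) +_) (sumℚ-map-*ˡ p B-side M) ⟩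
    sumℚ (map A-side M) + p * sumℚ (map B-side M)            ≡⟨ cong₂ (λ x y → x + p * y) (ℕtoℚ-sum _ M) (ℕtoℚ-sum _ M) ⟩
    ℕtoℚ (matchedCount proj₁ M G) + p * ℕtoℚ (matchedCount proj₂ M G)
      ≤⟨ ℚₚ.+-mono-≤ (ℕtoℚ-mono-≤ (matchedCount≤length proj₁ (AllPairs.map proj₁ matching) G))
                     (*-monoˡ-≤-0≤ 0≤p (ℕtoℚ-mono-≤ (matchedCount≤length proj₂ (AllPairs.map proj₂ matching) G))) ⟩
    ℕtoℚ (length G) + p * ℕtoℚ (length G)                   ≡⟨ solve 2 (λ p L → L :+ p :* L := (con 1ℚ :+ p) :* L) refl p _ ⟩
    (1ℚ + p) * ℕtoℚ (length G)                              ∎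
    where
    open ℚₚ.≤-Reasoning
    A-side B-side : Edge m n → ℚ
    A-side e = 𝟙 (matched proj₁ (proj₁ e) G)
    B-side e = 𝟙 (matched proj₂ (proj₂ e) G)

  module _ (π : List (Edge m n)) where

    greedyOn : Vec Bool m → List (Edge m n)
    greedyOn S = Greedy (restrict S π)

    credit-resampled≥p : ∀ {a b} {S₁ S₀ : Vec Bool m} → (a , b) ∈ π →
      lookup S₁ a ≡ true → lookup S₀ a ≡ false → (∀ j → j ≢ a → lookup S₁ j ≡ lookup S₀ j) →
      p ≤ p * credit (a , b) (greedyOn S₁) + q * credit (a , b) (greedyOn S₀)
    credit-resampled≥p {a} {b} {S₁} {S₀} ab∈π S₁[a]≡true S₀[a]≡false S₁≗S₀ =
      [ when-matched , when-unmatched ]′ (toSum (T? (matched proj₁ a (greedyOn S₁))))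
      where
      resampled : ℚ
      resampled = p * credit (a , b) (greedyOn S₁) + q * credit (a , b) (greedyOn S₀)

      when-matched : T (matched proj₁ a (greedyOn S₁)) → p ≤ resampled
      when-matched a-matched = begin
        p                                 ≡⟨ sym (ℚₚ.*-identityʳ p) ⟩
        p * 1ℚ                            ≤⟨ *-monoˡ-≤-0≤ 0≤p (credit≥1 {a} {b} (greedyOn S₁) a-matched) ⟩
        p * credit (a , b) (greedyOn S₁)  ≤⟨ p≤p+q (*-nonNeg 0≤q (credit-nonNeg (a , b) (greedyOn S₀))) ⟩
        resampled                         ∎
        where open ℚₚ.≤-Reasoning

      when-unmatched : ¬ T (matched proj₁ a (greedyOn S₁)) → p ≤ resampled
      when-unmatched a-unmatched = ℚₚ.≤-reflexive (begin
        p              ≡⟨ sym (p*x+q*x≡x p) ⟩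
        p * p + q * p  ≡⟨ cong₂ (λ x y → p * x + q * y) (sym credit₁≡p) (sym credit₀≡p) ⟩
        resampled      ∎)
        where
        open ≡-Reasoning
        same-greedy : greedyOn S₁ ≡ greedyOn S₀
        same-greedy = greedy-restrict-unmatched S₀[a]≡false S₁≗S₀ [] π a-unmatched
        b-matched : T (matched proj₂ b (greedyOn S₁))
        b-matched = [ ⊥-elim ∘ a-unmatched , id ]′ (Equivalence.to T-∨
          (subst T (conflicts≡matched∨matched (greedyOn S₁) a b)
            (greedy-maximal [] (restrict S₁ π) (restrict-∈ S₁ ab∈π S₁[a]≡true))))
        credit₁≡p : credit (a , b) (greedyOn S₁) ≡ p
        credit₁≡p = credit≡p {a} {b} (greedyOn S₁) a-unmatched b-matched
        credit₀≡p : credit (a , b) (greedyOn S₀) ≡ p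
        credit₀≡p = trans (cong (credit (a , b)) (sym same-greedy)) credit₁≡p

    𝔼-credit≥p : ∀ {e} → e ∈ π → p ≤ 𝔼 m (credit e ∘ greedyOn)
    𝔼-credit≥p {a , b} ab∈π = begin
      p                                            ≡⟨ sym (𝔼-const m p) ⟩
      𝔼 m (λ _ → p)                                ≤⟨ 𝔼-mono 0≤p 0≤q m resampled≥p ⟩
      𝔼 m (λ S → p * c (S [ a ]≔ true) + q * c (S [ a ]≔ false)) ≡⟨ sym (𝔼-resample m a c) ⟩
      𝔼 m c                                        ∎
      where
      open ℚₚ.≤-Reasoning
      c : Vec Bool m → ℚ
      c = credit (a , b) ∘ greedyOn
      resampled≥p : ∀ S → p ≤ p * c (S [ a ]≔ true) + q * c (S [ a ]≔ false)
      resampled≥p S = credit-resampled≥p ab∈π (lookup∘update a S true) (lookup∘update a S false)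
        (λ j j≢a → trans (lookup∘update′ j≢a S true) (sym (lookup∘update′ j≢a S false)))

    greedy-bound : ∀ {M} → AllPairs (λ e f → (proj₁ e ≢ proj₁ f) × (proj₂ e ≢ proj₂ f)) M → All (_∈ π) M →
      p * ℕtoℚ (length M) ≤ (1ℚ + p) * 𝔼 m (λ S → ℕtoℚ (length (greedyOn S)))
    greedy-bound {M} matching M⊆π = begin
      p * ℕtoℚ (length M)                                   ≡⟨ sym (sumℚ-map-const p M) ⟩
      sumℚ (map (λ _ → p) M)                                ≤⟨ sumℚ-mono M (All.map 𝔼-credit≥p M⊆π) ⟩
      sumℚ (map (λ e → 𝔼 m (credit e ∘ greedyOn)) M)       ≡⟨ sym (𝔼-sumℚ m (λ e → credit e ∘ greedyOn) M) ⟩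
      𝔼 m (λ S → sumℚ (map (λ e → credit e (greedyOn S)) M)) ≤⟨ 𝔼-mono 0≤p 0≤q m (credit-sum≤ matching ∘ greedyOn) ⟩
      𝔼 m (λ S → (1ℚ + p) * ℕtoℚ (length (greedyOn S)))    ≡⟨ 𝔼-*ˡ m (1ℚ + p) _ ⟩
      (1ℚ + p) * 𝔼 m (λ S → ℕtoℚ (length (greedyOn S)))    ∎
      where open ℚₚ.≤-Reasoning

theorem2 : (p : ℚ) → 0ℚ < p → p ≤ 1ℚ →
    (m n : ℕ) → (E : List (Edge m n)) → Unique E →
    (π : List (Edge m n)) → π ↭ E →
    (M : List (Edge m n)) → IsMaximumMatching E M →
    p * ℕtoℚ (length M) ≤ (1ℚ + p) * expectedGreedy p π
theorem2 p 0<p p≤1 m n E _ π π↭E M ((_ , M⊆E , matching) , _) = begin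
  p * ℕtoℚ (length M)                                    ≤⟨ greedy-bound π matching M⊆π ⟩
  (1ℚ + p) * 𝔼 m (λ S → ℕtoℚ (length (greedyOn π S)))   ≡⟨ cong ((1ℚ + p) *_) (sym (weightedSum≡𝔼 m _)) ⟩
  (1ℚ + p) * expectedGreedy p π                         ∎
  where
  open ℚₚ.≤-Reasoning
  0≤p : 0ℚ ≤ p
  0≤p = ℚₚ.<⇒≤ 0<p
  0≤1-p : 0ℚ ≤ 1ℚ - p
  0≤1-p = ℚₚ.≤-trans (ℚₚ.≤-reflexive (sym (ℚₚ.+-inverseʳ p))) (ℚₚ.+-monoˡ-≤ (- p) p≤1)
  open Expectation p
  open Analysis p 0≤p 0≤1-p
  M⊆π : All (_∈ π) M
  M⊆π = All.map (∈-resp-↭ (↭-sym π↭E)) M⊆E
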